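{- Let $a\in\mathbb N^n$ be a weak composition, $1\le i<n$, and $S,T\in\mathrm{SSKD}(a)$. Then $e_i(S)=T$ if and only if $f_i(T)=S$.
   Context: The diagram of $a$ has cells $(r,c)$ (row $r$ from the bottom, column $c$ from the left) with $1\le c\le a_r$, augmented (following Haglund–Haiman–Loehr) by a basement column $0$ whose cell $(r,0)$ contains $r$, basement cells being included in the conditions below (row lengths compared without basement). Fillings have entries in $\{1,\dots,n\}$. Cells attack if in the same column, or in adjacent columns with the left cell strictly higher; non-attacking: attacking cells have different entries. A triple: cells $(r,c),(r,c+1)$ with entries $i,j$ and a third with entry $k$, either $(s,c)$, $s>r$, row $r$ strictly longer than row $s$, or $(s,c+1)$, $s<r$, row $r$ weakly longer than row $s$; co-inversion if $i<j<k$, $j<k<i$ or $k<i<j$. $\mathrm{SSKD}(a)$: non-attacking fillings with no co-inversion triples. $i$-pairing: pair an $i$ and an $i+1$ in the same column, then iteratively pair an unpaired $i+1$ with an unpaired $i$ to its left whenever all entries $i,i+1$ between them are paired. Raising $e_i$: $0$ if no unpaired $i+1$; otherwise change the rightmost unpaired $i+1$ to $i$, swap $i,i+1$ in each of the consecutive columns immediately to its left having an $i+1$ in the same row and an $i$ above, and in each of the consecutive columns immediately to its right having an $i+1$ in the same row and an $i$ below. Lowering $f_i$: $f_i(T)=0$ if $T$ has no unpaired $i$, or if the leftmost unpaired $i$ is in row $i$ and all columns to its left have an $i$ in that row with an $i+1$ above it; otherwise change the leftmost unpaired $i$ to $i+1$, swap $i,i+1$ in each of the consecutive columns immediately to its left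 having an $i$ in the same row and an $i+1$ above, and in each of the consecutive columns immediately to its right having an $i$ in the same row and an $i+1$ below. -}

module Defs where

open import Data.Nat.Base using (ℕ; zero; suc; _≤_; _<_; _⊔_; _≡ᵇ_; _<ᵇ_)
open import Data.Bool.Base using (Bool; true; false; if_then_else_; _∧_; not)
open import Data.Maybe.Base using (Maybe; just; nothing; fromMaybe)
open import Data.List.Base as L using (List; []; _∷_; upTo; reverse; last; foldr; length)
open import Data.Bool.ListAction using (any; all)
open import Data.Vec.Base as V using (Vec; toList)
open import Data.Fin.Base using (Fin)
open import Data.Product.Base using (_×_; _,_)
open import Data.Sum.Base using (_⊎_)
open import Relation.Binary.PropositionalEquality using (_≡_; _≢_)
open import Relation.Nullary using (¬_)

-- A weak composition a ∈ ℕ^n is a  Vec ℕ n ; row r (1 ≤ r ≤ n, counted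
-- from the bottom) has length a_r = lookup a (r-1).
-- A filling of the diagram of a is a  Vec (List ℕ) n : the list in
-- position r-1 holds the entries of row r in columns 1, 2, ..., left to
-- right.  The basement column 0 (cell (r,0) containing r) is not stored
-- but is added by the accessor  ent .

Filling : ℕ → Set
Filling n = Vec (List ℕ) n

at : {A : Set} → List A → ℕ → Maybe A
at []       _       = nothing
at (x ∷ xs) zero    = just x
at (x ∷ xs) (suc k) = at xs k

updL : {A : Set} → List A → ℕ → (A → A) → List A
updL []       _       g = []
updL (x ∷ xs) zero    g = g x ∷ xs
updL (x ∷ xs) (suc k) g = x ∷ updL xs k g

updV : {A : Set} {m : ℕ} → Vec A m → ℕ → (A → A) → Vec A m
updV V.[]       _       g = V.[]
updV (x V.∷ xs) zero    g = g x V.∷ xs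
updV (x V.∷ xs) (suc k) g = x V.∷ updV xs k g

rowOf : {n : ℕ} → Filling n → ℕ → Maybe (List ℕ)
rowOf T zero    = nothing
rowOf T (suc r) = at (toList T) r

ent : {n : ℕ} → Filling n → ℕ → ℕ → Maybe ℕ
ent T r zero with rowOf T r
... | just _  = just r
... | nothing = nothing
ent T r (suc c) with rowOf T r
... | just row = at row c
... | nothing  = nothing

rowLen : {n : ℕ} → Vec ℕ n → ℕ → ℕ
rowLen a zero    = 0
rowLen a (suc r) = fromMaybe 0 (at (toList a) r)

CoInv : ℕ → ℕ → ℕ → Set
CoInv i j k = (i < j × j < k) ⊎ (j < k × k < i) ⊎ (k < i × i < j)

record SSKD {n : ℕ} (a : Vec ℕ n) (T : Filling n) : Set where
  field
    shape      : (r : Fin n) → length (V.lookup T r) ≡ V.lookup a r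
    entries    : ∀ r c v → ent T r c ≡ just v → 1 ≤ v × v ≤ n
    nonAttCol  : ∀ r s c u v → r ≢ s →
                 ent T r c ≡ just u → ent T s c ≡ just v → u ≢ v
    nonAttAdj  : ∀ r s c u v → s < r →
                 ent T r c ≡ just u → ent T s (suc c) ≡ just v → u ≢ v
    noCoInvA   : ∀ r s c x y z → r < s → rowLen a s < rowLen a r →
                 ent T r c ≡ just x → ent T r (suc c) ≡ just y →
                 ent T s c ≡ just z → ¬ CoInv x y z
    noCoInvB   : ∀ r s c x y z → s < r → rowLen a s ≤ rowLen a r →
                 ent T r c ≡ just x → ent T r (suc c) ≡ just y →
                 ent T s (suc c) ≡ just z → ¬ CoInv x y z

module _ {n : ℕ} (T : Filling n) where

  rows : List ℕ
  rows = L.map suc (upTo n)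

  hasAt : ℕ → ℕ → ℕ → Bool
  hasAt r c v with ent T r c
  ... | just x  = x ≡ᵇ v
  ... | nothing = false

  inCol : ℕ → ℕ → Bool
  inCol c v = any (λ r → hasAt r c v) rows

  findRow : ℕ → ℕ → Maybe ℕ
  findRow c v = L.findᵇ (λ r → hasAt r c v) rows

  maxLen : ℕ
  maxLen = foldr (λ row m → length row ⊔ m) 0 (toList T)

  cols : List ℕ
  cols = upTo (suc maxLen)

-- status of a column after pairing i with i+1 inside columns:
-- L = a single (unpaired) i, R = a single (unpaired) i+1, N = otherwise
data St : Set where
  Lst Rst Nst : St

status : {n : ℕ} → Filling n → ℕ → ℕ → St
status T i c with inCol T c i | inCol T c (suc i)
... | true  | false = Lst
... | false | true  = Rst
... | _     | _     = Nst

-- Iterated pairing of an unpaired i+1 with an unpaired i to its left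
-- when everything in between is paired = bracket matching, i ↦ "(",
-- i+1 ↦ ")".  scanR (left to right, counter of open i's) returns the
-- columns of the unpaired i+1's; scanL (run right to left, counter of
-- open i+1's) returns the columns of the unpaired i's.
scanR : ℕ → List (ℕ × St) → List ℕ
scanR k       []              = []
scanR k       ((c , Lst) ∷ xs) = scanR (suc k) xs
scanR zero    ((c , Rst) ∷ xs) = c ∷ scanR zero xs
scanR (suc k) ((c , Rst) ∷ xs) = scanR k xs
scanR k       ((c , Nst) ∷ xs) = scanR k xs

scanL : ℕ → List (ℕ × St) → List ℕ
scanL k       []              = []
scanL k       ((c , Rst) ∷ xs) = scanL (suc k) xs
scanL zero    ((c , Lst) ∷ xs) = c ∷ scanL zero xs
scanL (suc k) ((c , Lst) ∷ xs) = scanL k xs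
scanL k       ((c , Nst) ∷ xs) = scanL k xs

statuses : {n : ℕ} → Filling n → ℕ → List (ℕ × St)
statuses T i = L.map (λ c → c , status T i c) (cols T)

rightmostUnpairedR : {n : ℕ} → Filling n → ℕ → Maybe ℕ
rightmostUnpairedR T i = last (scanR 0 (statuses T i))

-- column of the leftmost unpaired i (scanL lists right to left)
leftmostUnpairedL : {n : ℕ} → Filling n → ℕ → Maybe ℕ
leftmostUnpairedL T i = last (scanL 0 (reverse (statuses T i)))

chainL : (ℕ → Bool) → ℕ → List ℕ
chainL p zero          = []
chainL p (suc zero)    = []
chainL p (suc (suc k)) = if p (suc k) then suc k ∷ chainL p (suc k) else []

chainR : (ℕ → Bool) → ℕ → ℕ → List ℕ
chainR p zero    c = []
chainR p (suc f) c = if p (suc c) then suc c ∷ chainR p f (suc c) else []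

swapV : ℕ → ℕ → ℕ
swapV i x = if x ≡ᵇ i then suc i else (if x ≡ᵇ suc i then i else x)

setCell : {n : ℕ} → Filling n → ℕ → ℕ → ℕ → Filling n
setCell T zero    c       v = T
setCell T (suc r) zero    v = T
setCell T (suc r) (suc c) v = updV T r (λ row → updL row c (λ _ → v))

swapCol : {n : ℕ} → ℕ → ℕ → Filling n → Filling n
swapCol i zero    T = T
swapCol i (suc c) T = V.map (λ row → updL row c (swapV i)) T

swapCols : {n : ℕ} → ℕ → List ℕ → Filling n → Filling n
swapCols i cs T = foldr (swapCol i) T cs

above below : {n : ℕ} → Filling n → ℕ → ℕ → ℕ → Bool
above T r c v = any (λ s → (r <ᵇ s) ∧ hasAt T s c v) (rows T)
below T r c v = any (λ s → (s <ᵇ r) ∧ hasAt T s c v) (rows T)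

raise : {n : ℕ} → ℕ → Filling n → Maybe (Filling n)
raise i T with rightmostUnpairedR T i
... | nothing = nothing
... | just c with findRow T c (suc i)
...   | nothing = nothing
...   | just r =
  just (swapCols i (chainL (λ c' → hasAt T r c' (suc i) ∧ above T r c' i) c)
         (swapCols i (chainR (λ c' → hasAt T r c' (suc i) ∧ below T r c' i) (maxLen T) c)
           (setCell T r c i)))

lower : {n : ℕ} → ℕ → Filling n → Maybe (Filling n)
lower i T with leftmostUnpairedL T i
... | nothing = nothing
... | just c with findRow T c i
...   | nothing = nothing
...   | just r =
  if (r ≡ᵇ i) ∧ all (λ c' → hasAt T r c' i ∧ above T r c' (suc i)) (upTo c)
  then nothing
  else just (swapCols i (chainL (λ c' → hasAt T r c' i ∧ above T r c' (suc i)) c)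
              (swapCols i (chainR (λ c' → hasAt T r c' i ∧ below T r c' (suc i)) (maxLen T) c)
                (setCell T r c (suc i))))

module Submission where

open import Defs
open import Data.Nat.Base
open import Data.Nat.Properties
open import Data.Bool.Base using (Bool; true; false; if_then_else_; _∧_; _∨_; T)
open import Data.Bool.ListAction using (any; all)
open import Data.Maybe.Base as M using (Maybe; just; nothing)
open import Data.Maybe.Properties using (just-injective)
open import Data.List.Base as L using (List; []; _∷_; _++_; _∷ʳ_; upTo; reverse; last)
open import Data.List.Properties
  using (reverse-++; unfold-reverse; reverse-involutive; ++-assoc; upTo-∷ʳ; map-++; map-cong-local)
open import Data.List.Membership.Propositional using (_∈_)
open import Data.List.Membership.Propositional.Properties using (∈-map⁺; ∈-upTo⁺; ∈-upTo⁻)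
open import Data.List.Relation.Unary.Any using (here; there)
open import Data.List.Relation.Unary.Any.Properties using (reverse⁻)
open import Data.List.Relation.Unary.All as All using (All; []; _∷_)
open import Data.List.Relation.Unary.All.Properties using (++⁺; ∷ʳ⁺)
open import Data.Vec.Base as V using (Vec)
open import Data.Vec.Properties using (length-toList; toList-map; toList-injective; cast-is-id)
open import Data.Product.Base using (_×_; _,_; proj₁; proj₂; Σ)
open import Data.Sum.Base using (_⊎_; inj₁; inj₂)
open import Data.Empty using (⊥; ⊥-elim)
open import Function.Bundles using (_⇔_; mk⇔; Equivalence)
open import Relation.Binary.PropositionalEquality
open import Relation.Nullary using (yes; no)

-- Both e_i and f_i are instances of one move on a non-attacking filling: change the entry u at a cell
-- (r,c) to its partner w ∈ {i, i+1} and exchange i and i+1 along the maximal chains of columns beside c.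
-- Performed again on the result with the roles of u and w exchanged, the move undoes itself, because
-- non-attacking forces the recomputed chains to be the old ones.  The move turns column c from an
-- unpaired i+1 into an unpaired i (or back) and keeps the status of every other column, so in the
-- bracket word of the i-pairing the rightmost unpaired i+1 sits at c before the move exactly when the
-- leftmost unpaired i sits at c after it.  Lastly f_i is not blocked on e_i(S): a blocking chain would
-- reach the basement of row r and force r = i+1.

at-map : ∀ {A B : Set} (f : A → B) (xs : List A) k → at (L.map f xs) k ≡ M.map f (at xs k)
at-map f []       k       = refl
at-map f (x ∷ xs) zero    = refl
at-map f (x ∷ xs) (suc k) = at-map f xs k

at-updL : ∀ {A : Set} (xs : List A) k g → at (updL xs k g) k ≡ M.map g (at xs k)
at-updL []       k       g = refl
at-updL (x ∷ xs) zero    g = refl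
at-updL (x ∷ xs) (suc k) g = at-updL xs k g

at-updL-≢ : ∀ {A : Set} (xs : List A) k j g → k ≢ j → at (updL xs k g) j ≡ at xs j
at-updL-≢ []       k       j       g k≢j = refl
at-updL-≢ (x ∷ xs) zero    zero    g k≢j = ⊥-elim (k≢j refl)
at-updL-≢ (x ∷ xs) zero    (suc j) g k≢j = refl
at-updL-≢ (x ∷ xs) (suc k) zero    g k≢j = refl
at-updL-≢ (x ∷ xs) (suc k) (suc j) g k≢j = at-updL-≢ xs k j g (λ e → k≢j (cong suc e))

at-just⇒< : ∀ {A : Set} (xs : List A) k {x} → at xs k ≡ just x → k < L.length xs
at-just⇒< (y ∷ xs) zero    e = s≤s z≤n
at-just⇒< (y ∷ xs) (suc k) e = s≤s (at-just⇒< xs k e)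

at-toList-< : ∀ {A : Set} {n} (X : Vec A n) k → k < n → Σ A λ x → at (V.toList X) k ≡ just x
at-toList-< (x V.∷ X) zero    k<n = x , refl
at-toList-< (x V.∷ X) (suc k) k<n = at-toList-< X k (≤-pred k<n)

at-ext : ∀ {A : Set} (xs ys : List A) → (∀ k → at xs k ≡ at ys k) → xs ≡ ys
at-ext []       []       h = refl
at-ext []       (y ∷ ys) h with () ← h 0
at-ext (x ∷ xs) []       h with () ← h 0
at-ext (x ∷ xs) (y ∷ ys) h with refl ← h 0 = cong (x ∷_) (at-ext xs ys (λ k → h (suc k)))

length-updL : ∀ {A : Set} (xs : List A) k g → L.length (updL xs k g) ≡ L.length xs
length-updL []       k       g = refl
length-updL (x ∷ xs) zero    g = refl
length-updL (x ∷ xs) (suc k) g = cong suc (length-updL xs k g)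

toList-updV : ∀ {A : Set} {n} (T : Vec A n) k g → V.toList (updV T k g) ≡ updL (V.toList T) k g
toList-updV V.[]      k       g = refl
toList-updV (x V.∷ T) zero    g = refl
toList-updV (x V.∷ T) (suc k) g = cong (x ∷_) (toList-updV T k g)

rowOf-map : ∀ {n} (f : List ℕ → List ℕ) (T : Filling n) r → rowOf (V.map f T) r ≡ M.map f (rowOf T r)
rowOf-map f T zero    = refl
rowOf-map f T (suc r) = trans (cong (λ xs → at xs r) (toList-map f T)) (at-map f (V.toList T) r)

rowOf-updV : ∀ {n} (T : Filling n) k g → rowOf (updV T k g) (suc k) ≡ M.map g (rowOf T (suc k))
rowOf-updV T k g = trans (cong (λ xs → at xs k) (toList-updV T k g)) (at-updL (V.toList T) k g)

rowOf-updV-≢ : ∀ {n} (T : Filling n) k g r → r ≢ suc k → rowOf (updV T k g) r ≡ rowOf T r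
rowOf-updV-≢ T k g zero    r≢ = refl
rowOf-updV-≢ T k g (suc r) r≢ =
  trans (cong (λ xs → at xs r) (toList-updV T k g)) (at-updL-≢ (V.toList T) k r g (λ e → r≢ (cong suc (sym e))))

-- ent as a function of the row, so that rewriting with the rowOf lemmas reaches it.
entryOf : Maybe (List ℕ) → ℕ → ℕ → Maybe ℕ
entryOf (just _)   r zero    = just r
entryOf nothing    r zero    = nothing
entryOf (just row) r (suc c) = at row c
entryOf nothing    r (suc c) = nothing

ent≡entryOf : ∀ {n} (T : Filling n) r c → ent T r c ≡ entryOf (rowOf T r) r c
ent≡entryOf T r zero    with rowOf T r
... | just _  = refl
... | nothing = refl
ent≡entryOf T r (suc c) with rowOf T r
... | just _  = refl
... | nothing = refl

entryOf-ext : ∀ (m m′ : Maybe (List ℕ)) r → (∀ c → entryOf m r c ≡ entryOf m′ r c) → m ≡ m′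
entryOf-ext (just xs) (just ys) r h = cong just (at-ext xs ys (λ c → h (suc c)))
entryOf-ext (just xs) nothing   r h with () ← h 0
entryOf-ext nothing   (just ys) r h with () ← h 0
entryOf-ext nothing   nothing   r h = refl

Filling-ext : ∀ {n} (F G : Filling n) → (∀ r c → ent F r c ≡ ent G r c) → F ≡ G
Filling-ext F G h = trans (sym (cast-is-id refl F)) (toList-injective refl F G (at-ext _ _ λ k → entryOf-ext _ _ (suc k) λ c →
  trans (sym (ent≡entryOf F (suc k) c)) (trans (h (suc k) c) (ent≡entryOf G (suc k) c))))

ent-swapCol : ∀ {n} i c (T : Filling n) r → ent (swapCol i (suc c) T) r (suc c) ≡ M.map (swapV i) (ent T r (suc c))
ent-swapCol i c T r rewrite ent≡entryOf (swapCol i (suc c) T) r (suc c) | ent≡entryOf T r (suc c)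
  | rowOf-map (λ row → updL row c (swapV i)) T r with rowOf T r
... | just row = at-updL row c (swapV i)
... | nothing  = refl

ent-swapCol-≢ : ∀ {n} i c (T : Filling n) r d → d ≢ c → ent (swapCol i c T) r d ≡ ent T r d
ent-swapCol-≢ i zero    T r d d≢c = refl
ent-swapCol-≢ i (suc c) T r d d≢c rewrite ent≡entryOf (swapCol i (suc c) T) r d | ent≡entryOf T r d
  | rowOf-map (λ row → updL row c (swapV i)) T r with rowOf T r | d
... | just row | zero   = refl
... | just row | suc d′ = at-updL-≢ row c d′ (swapV i) (λ e → d≢c (cong suc (sym e)))
... | nothing  | zero   = refl
... | nothing  | suc d′ = refl

ent-setCell : ∀ {n} (T : Filling n) r c v →
  ent (setCell T (suc r) (suc c) v) (suc r) (suc c) ≡ M.map (λ _ → v) (ent T (suc r) (suc c))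
ent-setCell T r c v rewrite ent≡entryOf (setCell T (suc r) (suc c) v) (suc r) (suc c) | ent≡entryOf T (suc r) (suc c)
  | rowOf-updV T r (λ row → updL row c (λ _ → v)) with rowOf T (suc r)
... | just row = at-updL row c (λ _ → v)
... | nothing  = refl

ent-setCell-≢ : ∀ {n} (T : Filling n) r c v r′ d → r′ ≢ suc r ⊎ d ≢ suc c →
  ent (setCell T (suc r) (suc c) v) r′ d ≡ ent T r′ d
ent-setCell-≢ T r c v r′ d h with r′ ≟ suc r
ent-setCell-≢ T r c v r′ d (inj₁ r′≢) | yes r′≡ = ⊥-elim (r′≢ r′≡)
ent-setCell-≢ T r c v .(suc r) d (inj₂ d≢) | yes refl
  rewrite ent≡entryOf (setCell T (suc r) (suc c) v) (suc r) d | ent≡entryOf T (suc r) d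
  | rowOf-updV T r (λ row → updL row c (λ _ → v)) with rowOf T (suc r) | d
... | just row | zero   = refl
... | just row | suc d′ = at-updL-≢ row c d′ _ (λ e → d≢ (cong suc (sym e)))
... | nothing  | zero   = refl
... | nothing  | suc d′ = refl
ent-setCell-≢ T r c v r′ d h | no r′≢
  rewrite ent≡entryOf (setCell T (suc r) (suc c) v) r′ d | ent≡entryOf T r′ d
  | rowOf-updV-≢ T r (λ row → updL row c (λ _ → v)) r′ r′≢ = refl

∨-true : ∀ a b → a ∨ b ≡ true → a ≡ true ⊎ b ≡ true
∨-true true  b e = inj₁ refl
∨-true false b e = inj₂ e

∧-true : ∀ a b → a ∧ b ≡ true → a ≡ true × b ≡ true
∧-true true true e = refl , refl

∧-intro : ∀ {a b} → a ≡ true → b ≡ true → a ∧ b ≡ true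
∧-intro refl refl = refl

≢true⇒false : ∀ {b} → b ≢ true → b ≡ false
≢true⇒false {true}  b≢ = ⊥-elim (b≢ refl)
≢true⇒false {false} b≢ = refl

true≢false : ∀ {b} → b ≡ true → b ≡ false → ⊥
true≢false refl ()

≡ᵇ-sound : ∀ m n → (m ≡ᵇ n) ≡ true → m ≡ n
≡ᵇ-sound m n e = ≡ᵇ⇒≡ m n (subst T (sym e) _)

≡ᵇ-refl : ∀ m → (m ≡ᵇ m) ≡ true
≡ᵇ-refl zero    = refl
≡ᵇ-refl (suc m) = ≡ᵇ-refl m

≡ᵇ-≢ : ∀ m n → m ≢ n → (m ≡ᵇ n) ≡ false
≡ᵇ-≢ m n m≢n = ≢true⇒false λ e → m≢n (≡ᵇ-sound m n e)

<ᵇ-sound : ∀ m n → (m <ᵇ n) ≡ true → m < n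
<ᵇ-sound m n e = <ᵇ⇒< m n (subst T (sym e) _)

<ᵇ-complete : ∀ {m n} → m < n → (m <ᵇ n) ≡ true
<ᵇ-complete {m} {n} m<n with m <ᵇ n | <⇒<ᵇ m<n
... | true | _ = refl

any-intro : ∀ {A : Set} (p : A → Bool) {x} xs → x ∈ xs → p x ≡ true → any p xs ≡ true
any-intro p (y ∷ xs) (here refl) px rewrite px = refl
any-intro p (y ∷ xs) (there x∈) px with p y
... | true  = refl
... | false = any-intro p xs x∈ px

any-elim : ∀ {A : Set} (p : A → Bool) xs → any p xs ≡ true → Σ A λ x → x ∈ xs × p x ≡ true
any-elim p (y ∷ xs) e with p y in py
... | true  = y , here refl , py
... | false with x , x∈ , px ← any-elim p xs e = x , there x∈ , px

any-cong : ∀ {A : Set} (p q : A → Bool) xs → (∀ x → p x ≡ q x) → any p xs ≡ any q xs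
any-cong p q []       h = refl
any-cong p q (x ∷ xs) h = cong₂ _∨_ (h x) (any-cong p q xs h)

all-elim : ∀ {A : Set} (p : A → Bool) xs {x} → all p xs ≡ true → x ∈ xs → p x ≡ true
all-elim p (y ∷ xs) e (here refl) = proj₁ (∧-true (p y) _ e)
all-elim p (y ∷ xs) e (there x∈) = all-elim p xs (proj₂ (∧-true (p y) _ e)) x∈

findᵇ-sound : ∀ {A : Set} (p : A → Bool) xs {y} → L.findᵇ p xs ≡ just y → p y ≡ true
findᵇ-sound p (x ∷ xs) e with p x in px
findᵇ-sound p (x ∷ xs) refl | true = px
... | false = findᵇ-sound p xs e

findᵇ-complete : ∀ {A : Set} (p : A → Bool) xs {x} → x ∈ xs → p x ≡ true → Σ A λ y → L.findᵇ p xs ≡ just y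
findᵇ-complete p (y ∷ xs) x∈ px with p y in py
... | true = y , refl
findᵇ-complete p (y ∷ xs) (here refl) px | false = ⊥-elim (true≢false px py)
findᵇ-complete p (y ∷ xs) (there x∈) px | false = findᵇ-complete p xs x∈ px

hasEntry : Maybe ℕ → ℕ → Bool
hasEntry (just x) v = x ≡ᵇ v
hasEntry nothing  v = false

hasAt≡hasEntry : ∀ {n} (T : Filling n) r c v → hasAt T r c v ≡ hasEntry (ent T r c) v
hasAt≡hasEntry T r c v with ent T r c
... | just x  = refl
... | nothing = refl

hasAt-sound : ∀ {n} (T : Filling n) r c v → hasAt T r c v ≡ true → ent T r c ≡ just v
hasAt-sound T r c v e with ent T r c | hasAt≡hasEntry T r c v
... | just x | refl = cong just (≡ᵇ-sound x v e)

hasAt-complete : ∀ {n} (T : Filling n) r c v → ent T r c ≡ just v → hasAt T r c v ≡ true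
hasAt-complete T r c v e rewrite hasAt≡hasEntry T r c v | e = ≡ᵇ-refl v

ent⇒∈rows : ∀ {n} (T : Filling n) r c {v} → ent T r c ≡ just v → r ∈ rows T
ent⇒∈rows T zero c e rewrite ent≡entryOf T zero c with c | e
... | zero  | ()
... | suc _ | ()
ent⇒∈rows T (suc r) c e rewrite ent≡entryOf T (suc r) c with at (V.toList T) r in row | c | e
... | just _  | _     | _  =
  ∈-map⁺ suc (∈-upTo⁺ (subst (r <_) (length-toList T) (at-just⇒< (V.toList T) r row)))
... | nothing | zero  | ()
... | nothing | suc _ | ()

inCol-intro : ∀ {n} (T : Filling n) r c v → ent T r c ≡ just v → inCol T c v ≡ true
inCol-intro T r c v e = any-intro (λ r → hasAt T r c v) (rows T) (ent⇒∈rows T r c e) (hasAt-complete T r c v e)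

inCol-elim : ∀ {n} (T : Filling n) c v → inCol T c v ≡ true → Σ ℕ λ r → ent T r c ≡ just v
inCol-elim T c v e with r , _ , h ← any-elim (λ r → hasAt T r c v) (rows T) e = r , hasAt-sound T r c v h

inCol-false : ∀ {n} (T : Filling n) c v → (∀ r → ent T r c ≢ just v) → inCol T c v ≡ false
inCol-false T c v h = ≢true⇒false λ e → let (r , er) = inCol-elim T c v e in h r er

above-intro : ∀ {n} (T : Filling n) r s c v → r < s → ent T s c ≡ just v → above T r c v ≡ true
above-intro T r s c v r<s e =
  any-intro _ (rows T) (ent⇒∈rows T s c e) (∧-intro (<ᵇ-complete r<s) (hasAt-complete T s c v e))

above-elim : ∀ {n} (T : Filling n) r c v → above T r c v ≡ true → Σ ℕ λ s → r < s × ent T s c ≡ just v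
above-elim T r c v e with s , _ , h ← any-elim (λ s → (r <ᵇ s) ∧ hasAt T s c v) (rows T) e
  with h₁ , h₂ ← ∧-true (r <ᵇ s) _ h = s , <ᵇ-sound r s h₁ , hasAt-sound T s c v h₂

below-intro : ∀ {n} (T : Filling n) r s c v → s < r → ent T s c ≡ just v → below T r c v ≡ true
below-intro T r s c v s<r e =
  any-intro _ (rows T) (ent⇒∈rows T s c e) (∧-intro (<ᵇ-complete s<r) (hasAt-complete T s c v e))

below-elim : ∀ {n} (T : Filling n) r c v → below T r c v ≡ true → Σ ℕ λ s → s < r × ent T s c ≡ just v
below-elim T r c v e with s , _ , h ← any-elim (λ s → (s <ᵇ r) ∧ hasAt T s c v) (rows T) e
  with h₁ , h₂ ← ∧-true (s <ᵇ r) _ h = s , <ᵇ-sound s r h₁ , hasAt-sound T s c v h₂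

findRow-sound : ∀ {n} (T : Filling n) c v {r} → findRow T c v ≡ just r → ent T r c ≡ just v
findRow-sound T c v {r} e = hasAt-sound T r c v (findᵇ-sound (λ r → hasAt T r c v) (rows T) e)

findRow-unique : ∀ {n} (T : Filling n) c v r → ent T r c ≡ just v →
  (∀ r′ → ent T r′ c ≡ just v → r′ ≡ r) → findRow T c v ≡ just r
findRow-unique T c v r e unique
  with y , found ← findᵇ-complete (λ r → hasAt T r c v) (rows T) (ent⇒∈rows T r c e) (hasAt-complete T r c v e)
  = trans found (cong just (unique y (findRow-sound T c v found)))

statusOf : Bool → Bool → St
statusOf true  false = Lst
statusOf false true  = Rst
statusOf true  true  = Nst
statusOf false false = Nst

status≡statusOf : ∀ {n} (T : Filling n) i c → status T i c ≡ statusOf (inCol T c i) (inCol T c (suc i))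
status≡statusOf T i c with inCol T c i | inCol T c (suc i)
... | true  | true  = refl
... | true  | false = refl
... | false | true  = refl
... | false | false = refl

inCol-column-cong : ∀ {n} (S T : Filling n) d v → (∀ r → ent S r d ≡ ent T r d) → inCol S d v ≡ inCol T d v
inCol-column-cong S T d v same =
  any-cong _ _ (rows S) λ r → trans (hasAt≡hasEntry S r d v) (trans (cong (λ x → hasEntry x v) (same r)) (sym (hasAt≡hasEntry T r d v)))

status-column-cong : ∀ {n} (S T : Filling n) i d → (∀ r → ent S r d ≡ ent T r d) → status S i d ≡ status T i d
status-column-cong S T i d same rewrite status≡statusOf S i d | status≡statusOf T i d
  | inCol-column-cong S T d i same | inCol-column-cong S T d (suc i) same = refl

maxLenOf : List (List ℕ) → ℕ
maxLenOf = L.foldr (λ row m → L.length row ⊔ m) 0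

maxLenOf-map : ∀ (f : List ℕ → List ℕ) → (∀ row → L.length (f row) ≡ L.length row) →
  ∀ rs → maxLenOf (L.map f rs) ≡ maxLenOf rs
maxLenOf-map f h []         = refl
maxLenOf-map f h (row ∷ rs) = cong₂ _⊔_ (h row) (maxLenOf-map f h rs)

maxLenOf-updL : ∀ (f : List ℕ → List ℕ) → (∀ row → L.length (f row) ≡ L.length row) →
  ∀ rs k → maxLenOf (updL rs k f) ≡ maxLenOf rs
maxLenOf-updL f h []         k       = refl
maxLenOf-updL f h (row ∷ rs) zero    = cong (_⊔ maxLenOf rs) (h row)
maxLenOf-updL f h (row ∷ rs) (suc k) = cong (L.length row ⊔_) (maxLenOf-updL f h rs k)

maxLen-swapCol : ∀ {n} i c (T : Filling n) → maxLen (swapCol i c T) ≡ maxLen T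
maxLen-swapCol i zero    T = refl
maxLen-swapCol i (suc c) T =
  trans (cong maxLenOf (toList-map _ T)) (maxLenOf-map _ (λ row → length-updL row c _) (V.toList T))

maxLen-swapCols : ∀ {n} i cs (T : Filling n) → maxLen (swapCols i cs T) ≡ maxLen T
maxLen-swapCols i []       T = refl
maxLen-swapCols i (c ∷ cs) T = trans (maxLen-swapCol i c (swapCols i cs T)) (maxLen-swapCols i cs T)

maxLen-setCell : ∀ {n} (T : Filling n) r c v → maxLen (setCell T r c v) ≡ maxLen T
maxLen-setCell T zero    c       v = refl
maxLen-setCell T (suc r) zero    v = refl
maxLen-setCell T (suc r) (suc c) v =
  trans (cong maxLenOf (toList-updV T r _)) (maxLenOf-updL _ (λ row → length-updL row c _) (V.toList T) r)

inChainL : (ℕ → Bool) → ℕ → ℕ → Bool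
inChainL p zero          d = false
inChainL p (suc zero)    d = false
inChainL p (suc (suc k)) d = if p (suc k) then (d ≡ᵇ suc k) ∨ inChainL p (suc k) d else false

inChainR : (ℕ → Bool) → ℕ → ℕ → ℕ → Bool
inChainR p zero    c d = false
inChainR p (suc f) c d = if p (suc c) then (d ≡ᵇ suc c) ∨ inChainR p f (suc c) d else false

ChainL : (ℕ → Bool) → ℕ → ℕ → Set
ChainL p m d = 1 ≤ d × d < m × (∀ e → d ≤ e → e < m → p e ≡ true)

ChainR : (ℕ → Bool) → ℕ → ℕ → ℕ → Set
ChainR p f c d = c < d × d ≤ c + f × (∀ e → c < e → e ≤ d → p e ≡ true)

<-suc-cases : ∀ {m n} → m < suc n → m < n ⊎ m ≡ n
<-suc-cases m<1+n = m≤n⇒m<n∨m≡n (≤-pred m<1+n)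

suc-≤-+-suc : ∀ c f → suc c ≤ c + suc f
suc-≤-+-suc c f = subst (suc c ≤_) (sym (+-suc c f)) (s≤s (m≤m+n c f))

extend-above : ∀ {P Q : ℕ → Set} {m} → P m → (∀ e → Q e → e < m → P e) → ∀ e → Q e → e < suc m → P e
extend-above Pm P< e Qe e<1+m with <-suc-cases e<1+m
... | inj₁ e<m  = P< e Qe e<m
... | inj₂ refl = Pm

extend-≤ : ∀ {P Q : ℕ → Set} {d} → P d → (∀ e → d < e → Q e → P e) → ∀ e → d ≤ e → Q e → P e
extend-≤ Pd P> e d≤e Qe with m≤n⇒m<n∨m≡n d≤e
... | inj₁ d<e  = P> e d<e Qe
... | inj₂ refl = Pd

extend-≥ : ∀ {P Q : ℕ → Set} {d} → P d → (∀ e → Q e → e < d → P e) → ∀ e → Q e → e ≤ d → P e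
extend-≥ Pd P< e Qe e≤d with m≤n⇒m<n∨m≡n e≤d
... | inj₁ e<d  = P< e Qe e<d
... | inj₂ refl = Pd

inChainL⇒-step : ∀ p m d → (inChainL p m d ≡ true → ChainL p m d) → inChainL p (suc m) d ≡ true → ChainL p (suc m) d
inChainL⇒-step p (suc k) d IH h with p (suc k) in pk
... | true with ∨-true (d ≡ᵇ suc k) _ h
...   | inj₁ d≡k with refl ← ≡ᵇ-sound d (suc k) d≡k =
  s≤s z≤n , ≤-refl , λ e d≤e e<m → subst (λ x → p x ≡ true) (≤-antisym d≤e (≤-pred e<m)) pk
...   | inj₂ rest with 1≤d , d<m , chain ← IH rest =
  1≤d , m<n⇒m<1+n d<m , extend-above {λ x → p x ≡ true} pk chain

inChainL⇒ : ∀ p m d → inChainL p m d ≡ true → ChainL p m d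
inChainL⇒ p (suc m) d = inChainL⇒-step p m d (inChainL⇒ p m d)

inChainL⇐-step : ∀ p m d → (ChainL p m d → inChainL p m d ≡ true) → ChainL p (suc m) d → inChainL p (suc m) d ≡ true
inChainL⇐-step p zero    zero    IH (() , _)
inChainL⇐-step p zero    (suc d) IH (_ , s≤s () , _)
inChainL⇐-step p (suc k) d IH (1≤d , d<m , chain) rewrite chain (suc k) (≤-pred d<m) ≤-refl
  with <-suc-cases d<m
... | inj₂ refl rewrite ≡ᵇ-refl (suc k) = refl
... | inj₁ d<k rewrite IH (1≤d , d<k , λ e d≤e e<k → chain e d≤e (m<n⇒m<1+n e<k)) with d ≡ᵇ suc k
...   | true  = refl
...   | false = refl

inChainL⇐ : ∀ p m d → ChainL p m d → inChainL p m d ≡ true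
inChainL⇐ p zero    d (_ , () , _)
inChainL⇐ p (suc m) d = inChainL⇐-step p m d (inChainL⇐ p m d)

inChainR⇒-step : ∀ p f c d → (inChainR p f (suc c) d ≡ true → ChainR p f (suc c) d) →
  inChainR p (suc f) c d ≡ true → ChainR p (suc f) c d
inChainR⇒-step p f c d IH h with p (suc c) in pc
... | true with ∨-true (d ≡ᵇ suc c) _ h
...   | inj₁ d≡c with refl ← ≡ᵇ-sound d (suc c) d≡c =
  ≤-refl , suc-≤-+-suc c f , λ e c<e e≤d → subst (λ x → p x ≡ true) (≤-antisym c<e e≤d) pc
...   | inj₂ rest with c<d , d≤ , chain ← IH rest =
  <-trans ≤-refl c<d , subst (d ≤_) (sym (+-suc c f)) d≤ , extend-≤ {λ x → p x ≡ true} pc chain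

inChainR⇒ : ∀ p f c d → inChainR p f c d ≡ true → ChainR p f c d
inChainR⇒ p (suc f) c d = inChainR⇒-step p f c d (inChainR⇒ p f (suc c) d)

inChainR⇐-step : ∀ p f c d → (ChainR p f (suc c) d → inChainR p f (suc c) d ≡ true) →
  ChainR p (suc f) c d → inChainR p (suc f) c d ≡ true
inChainR⇐-step p f c d IH (c<d , d≤ , chain) rewrite chain (suc c) ≤-refl c<d with m≤n⇒m<n∨m≡n c<d
... | inj₂ refl rewrite ≡ᵇ-refl (suc c) = refl
... | inj₁ 1+c<d rewrite IH (1+c<d , subst (d ≤_) (+-suc c f) d≤ , λ e lt e≤d → chain e (<-trans ≤-refl lt) e≤d)
  with d ≡ᵇ suc c
...   | true  = refl
...   | false = refl

inChainR⇐ : ∀ p f c d → ChainR p f c d → inChainR p f c d ≡ true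
inChainR⇐ p zero    c d (c<d , d≤ , _) = ⊥-elim (<⇒≱ c<d (subst (d ≤_) (+-identityʳ c) d≤))
inChainR⇐ p (suc f) c d = inChainR⇐-step p f c d (inChainR⇐ p f (suc c) d)

swapIf : ℕ → Bool → Maybe ℕ → Maybe ℕ
swapIf i b x = if b then M.map (swapV i) x else x

ent-swapCols-chainL-step : ∀ {n} i p m (Z : Filling n) r →
  (∀ d → ent (swapCols i (chainL p m) Z) r d ≡ swapIf i (inChainL p m d) (ent Z r d)) →
  ∀ d → ent (swapCols i (chainL p (suc m)) Z) r d ≡ swapIf i (inChainL p (suc m) d) (ent Z r d)
ent-swapCols-chainL-step i p zero    Z r IH d = refl
ent-swapCols-chainL-step i p (suc k) Z r IH d with p (suc k) in pk
... | false = refl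
... | true with d ≟ suc k
...   | yes refl rewrite ≡ᵇ-refl (suc k) | ent-swapCol i k (swapCols i (chainL p (suc k)) Z) r | IH (suc k)
  with inChainL p (suc k) (suc k) in k∈
...     | false = refl
...     | true  = ⊥-elim (<-irrefl refl (proj₁ (proj₂ (inChainL⇒ p (suc k) (suc k) k∈))))
ent-swapCols-chainL-step i p (suc k) Z r IH d | true | no d≢k
  rewrite ≡ᵇ-≢ d (suc k) d≢k | ent-swapCol-≢ i (suc k) (swapCols i (chainL p (suc k)) Z) r d d≢k = IH d

ent-swapCols-chainL : ∀ {n} i p m (Z : Filling n) r d →
  ent (swapCols i (chainL p m) Z) r d ≡ swapIf i (inChainL p m d) (ent Z r d)
ent-swapCols-chainL i p zero    Z r d = refl
ent-swapCols-chainL i p (suc m) Z r = ent-swapCols-chainL-step i p m Z r (ent-swapCols-chainL i p m Z r)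

ent-swapCols-chainR-step : ∀ {n} i p f c (Z : Filling n) r →
  (∀ d → ent (swapCols i (chainR p f (suc c)) Z) r d ≡ swapIf i (inChainR p f (suc c) d) (ent Z r d)) →
  ∀ d → ent (swapCols i (chainR p (suc f) c) Z) r d ≡ swapIf i (inChainR p (suc f) c d) (ent Z r d)
ent-swapCols-chainR-step i p f c Z r IH d with p (suc c) in pc
... | false = refl
... | true with d ≟ suc c
...   | yes refl rewrite ≡ᵇ-refl (suc c) | ent-swapCol i c (swapCols i (chainR p f (suc c)) Z) r | IH (suc c)
  with inChainR p f (suc c) (suc c) in c∈
...     | false = refl
...     | true  = ⊥-elim (<-irrefl refl (proj₁ (inChainR⇒ p f (suc c) (suc c) c∈)))
ent-swapCols-chainR-step i p f c Z r IH d | true | no d≢c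
  rewrite ≡ᵇ-≢ d (suc c) d≢c | ent-swapCol-≢ i (suc c) (swapCols i (chainR p f (suc c)) Z) r d d≢c = IH d

ent-swapCols-chainR : ∀ {n} i p f c (Z : Filling n) r d →
  ent (swapCols i (chainR p f c) Z) r d ≡ swapIf i (inChainR p f c d) (ent Z r d)
ent-swapCols-chainR i p zero    c Z r d = refl
ent-swapCols-chainR i p (suc f) c Z r =
  ent-swapCols-chainR-step i p f c Z r (ent-swapCols-chainR i p f (suc c) Z r)

chainL-cong-step : ∀ (p q : ℕ → Bool) m →
  ((∀ d → 1 ≤ d → d < m → (∀ e → d < e → e < m → p e ≡ true) → q d ≡ p d) → chainL q m ≡ chainL p m) →
  (∀ d → 1 ≤ d → d < suc m → (∀ e → d < e → e < suc m → p e ≡ true) → q d ≡ p d) →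
  chainL q (suc m) ≡ chainL p (suc m)
chainL-cong-step p q zero    IH h = refl
chainL-cong-step p q (suc k) IH h rewrite h (suc k) (s≤s z≤n) ≤-refl (λ e k<e e<m → ⊥-elim (<⇒≱ k<e (≤-pred e<m)))
  with p (suc k) in pk
... | false = refl
... | true  = cong (suc k ∷_) (IH λ d 1≤d d<k chain →
  h d 1≤d (m<n⇒m<1+n d<k) (extend-above {λ x → p x ≡ true} pk chain))

chainL-cong : ∀ (p q : ℕ → Bool) m → (∀ d → 1 ≤ d → d < m → (∀ e → d < e → e < m → p e ≡ true) → q d ≡ p d) →
  chainL q m ≡ chainL p m
chainL-cong p q zero    h = refl
chainL-cong p q (suc m) = chainL-cong-step p q m (chainL-cong p q m)

chainR-cong-step : ∀ (p q : ℕ → Bool) f c →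
  ((∀ d → suc c < d → d ≤ suc c + f → (∀ e → suc c < e → e < d → p e ≡ true) → q d ≡ p d) →
    chainR q f (suc c) ≡ chainR p f (suc c)) →
  (∀ d → c < d → d ≤ c + suc f → (∀ e → c < e → e < d → p e ≡ true) → q d ≡ p d) →
  chainR q (suc f) c ≡ chainR p (suc f) c
chainR-cong-step p q f c IH h
  rewrite h (suc c) ≤-refl (suc-≤-+-suc c f) (λ e c<e e<c → ⊥-elim (<⇒≱ c<e (≤-pred e<c)))
  with p (suc c) in pc
... | false = refl
... | true  = cong (suc c ∷_) (IH λ d 1+c<d d≤ chain →
  h d (<-trans ≤-refl 1+c<d) (subst (d ≤_) (sym (+-suc c f)) d≤) (extend-≤ {λ x → p x ≡ true} pc chain))

chainR-cong : ∀ (p q : ℕ → Bool) f c → (∀ d → c < d → d ≤ c + f → (∀ e → c < e → e < d → p e ≡ true) → q d ≡ p d) →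
  chainR q f c ≡ chainR p f c
chainR-cong p q zero    c h = refl
chainR-cong p q (suc f) c = chainR-cong-step p q f c (chainR-cong p q f (suc c))

Word : Set
Word = List (ℕ × St)

depthR : ℕ → Word → ℕ
depthR k       []               = k
depthR k       ((c , Lst) ∷ xs) = depthR (suc k) xs
depthR zero    ((c , Rst) ∷ xs) = depthR zero xs
depthR (suc k) ((c , Rst) ∷ xs) = depthR k xs
depthR k       ((c , Nst) ∷ xs) = depthR k xs

depthL : ℕ → Word → ℕ
depthL k       []               = k
depthL k       ((c , Rst) ∷ xs) = depthL (suc k) xs
depthL zero    ((c , Lst) ∷ xs) = depthL zero xs
depthL (suc k) ((c , Lst) ∷ xs) = depthL k xs
depthL k       ((c , Nst) ∷ xs) = depthL k xs

scanR-++ : ∀ k (xs ys : Word) → scanR k (xs ++ ys) ≡ scanR k xs ++ scanR (depthR k xs) ys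
scanR-++ k       []               ys = refl
scanR-++ k       ((c , Lst) ∷ xs) ys = scanR-++ (suc k) xs ys
scanR-++ zero    ((c , Rst) ∷ xs) ys = cong (c ∷_) (scanR-++ zero xs ys)
scanR-++ (suc k) ((c , Rst) ∷ xs) ys = scanR-++ k xs ys
scanR-++ k       ((c , Nst) ∷ xs) ys = scanR-++ k xs ys

depthR-++ : ∀ k (xs ys : Word) → depthR k (xs ++ ys) ≡ depthR (depthR k xs) ys
depthR-++ k       []               ys = refl
depthR-++ k       ((c , Lst) ∷ xs) ys = depthR-++ (suc k) xs ys
depthR-++ zero    ((c , Rst) ∷ xs) ys = depthR-++ zero xs ys
depthR-++ (suc k) ((c , Rst) ∷ xs) ys = depthR-++ k xs ys
depthR-++ k       ((c , Nst) ∷ xs) ys = depthR-++ k xs ys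

scanL-++ : ∀ k (xs ys : Word) → scanL k (xs ++ ys) ≡ scanL k xs ++ scanL (depthL k xs) ys
scanL-++ k       []               ys = refl
scanL-++ k       ((c , Rst) ∷ xs) ys = scanL-++ (suc k) xs ys
scanL-++ zero    ((c , Lst) ∷ xs) ys = cong (c ∷_) (scanL-++ zero xs ys)
scanL-++ (suc k) ((c , Lst) ∷ xs) ys = scanL-++ k xs ys
scanL-++ k       ((c , Nst) ∷ xs) ys = scanL-++ k xs ys

depthL-++ : ∀ k (xs ys : Word) → depthL k (xs ++ ys) ≡ depthL (depthL k xs) ys
depthL-++ k       []               ys = refl
depthL-++ k       ((c , Rst) ∷ xs) ys = depthL-++ (suc k) xs ys
depthL-++ zero    ((c , Lst) ∷ xs) ys = depthL-++ zero xs ys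
depthL-++ (suc k) ((c , Lst) ∷ xs) ys = depthL-++ k xs ys
depthL-++ k       ((c , Nst) ∷ xs) ys = depthL-++ k xs ys

unpairedR : Word → ℕ
unpairedR w = depthL 0 (reverse w)

unpairedR-∷ : ∀ x (w : Word) → unpairedR (x ∷ w) ≡ depthL (unpairedR w) (x ∷ [])
unpairedR-∷ x w rewrite unfold-reverse x w = depthL-++ 0 (reverse w) (x ∷ [])

scanR≡[]⇒unpairedR≤ : ∀ (w : Word) k → scanR k w ≡ [] → unpairedR w ≤ k
scanR≡[]⇒unpairedR≤ []              k       e = z≤n
scanR≡[]⇒unpairedR≤ ((c , Lst) ∷ w) k       e rewrite unpairedR-∷ (c , Lst) w
  with unpairedR w | scanR≡[]⇒unpairedR≤ w (suc k) e
... | zero  | _ = z≤n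
... | suc m | h = ≤-pred h
scanR≡[]⇒unpairedR≤ ((c , Rst) ∷ w) zero    ()
scanR≡[]⇒unpairedR≤ ((c , Rst) ∷ w) (suc k) e rewrite unpairedR-∷ (c , Rst) w = s≤s (scanR≡[]⇒unpairedR≤ w k e)
scanR≡[]⇒unpairedR≤ ((c , Nst) ∷ w) k       e rewrite unpairedR-∷ (c , Nst) w = scanR≡[]⇒unpairedR≤ w k e

≤-suc-depthL-Lst : ∀ c m → m ≤ suc (depthL m ((c , Lst) ∷ []))
≤-suc-depthL-Lst c zero    = z≤n
≤-suc-depthL-Lst c (suc m) = ≤-refl

unpairedR≤⇒scanR≡[] : ∀ (w : Word) k → unpairedR w ≤ k → scanR k w ≡ []
unpairedR≤⇒scanR≡[] []              k       h = refl
unpairedR≤⇒scanR≡[] ((c , Lst) ∷ w) k       h rewrite unpairedR-∷ (c , Lst) w =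
  unpairedR≤⇒scanR≡[] w (suc k) (≤-trans (≤-suc-depthL-Lst c (unpairedR w)) (s≤s h))
unpairedR≤⇒scanR≡[] ((c , Rst) ∷ w) zero    h rewrite unpairedR-∷ (c , Rst) w with () ← h
unpairedR≤⇒scanR≡[] ((c , Rst) ∷ w) (suc k) h rewrite unpairedR-∷ (c , Rst) w = unpairedR≤⇒scanR≡[] w k (≤-pred h)
unpairedR≤⇒scanR≡[] ((c , Nst) ∷ w) k       h rewrite unpairedR-∷ (c , Nst) w = unpairedR≤⇒scanR≡[] w k h

unpairedL : Word → ℕ
unpairedL w = depthR 0 (reverse w)

unpairedL-∷ : ∀ x (w : Word) → unpairedL (x ∷ w) ≡ depthR (unpairedL w) (x ∷ [])
unpairedL-∷ x w rewrite unfold-reverse x w = depthR-++ 0 (reverse w) (x ∷ [])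

scanL≡[]⇒unpairedL≤ : ∀ (w : Word) k → scanL k w ≡ [] → unpairedL w ≤ k
scanL≡[]⇒unpairedL≤ []              k       e = z≤n
scanL≡[]⇒unpairedL≤ ((c , Rst) ∷ w) k       e rewrite unpairedL-∷ (c , Rst) w
  with unpairedL w | scanL≡[]⇒unpairedL≤ w (suc k) e
... | zero  | _ = z≤n
... | suc m | h = ≤-pred h
scanL≡[]⇒unpairedL≤ ((c , Lst) ∷ w) zero    ()
scanL≡[]⇒unpairedL≤ ((c , Lst) ∷ w) (suc k) e rewrite unpairedL-∷ (c , Lst) w = s≤s (scanL≡[]⇒unpairedL≤ w k e)
scanL≡[]⇒unpairedL≤ ((c , Nst) ∷ w) k       e rewrite unpairedL-∷ (c , Nst) w = scanL≡[]⇒unpairedL≤ w k e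

≤-suc-depthR-Rst : ∀ c m → m ≤ suc (depthR m ((c , Rst) ∷ []))
≤-suc-depthR-Rst c zero    = z≤n
≤-suc-depthR-Rst c (suc m) = ≤-refl

unpairedL≤⇒scanL≡[] : ∀ (w : Word) k → unpairedL w ≤ k → scanL k w ≡ []
unpairedL≤⇒scanL≡[] []              k       h = refl
unpairedL≤⇒scanL≡[] ((c , Rst) ∷ w) k       h rewrite unpairedL-∷ (c , Rst) w =
  unpairedL≤⇒scanL≡[] w (suc k) (≤-trans (≤-suc-depthR-Rst c (unpairedL w)) (s≤s h))
unpairedL≤⇒scanL≡[] ((c , Lst) ∷ w) zero    h rewrite unpairedL-∷ (c , Lst) w with () ← h
unpairedL≤⇒scanL≡[] ((c , Lst) ∷ w) (suc k) h rewrite unpairedL-∷ (c , Lst) w = unpairedL≤⇒scanL≡[] w k (≤-pred h)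
unpairedL≤⇒scanL≡[] ((c , Nst) ∷ w) k       h rewrite unpairedL-∷ (c , Nst) w = unpairedL≤⇒scanL≡[] w k h

Avoids : ℕ → Word → Set
Avoids c w = All (λ x → proj₁ x ≢ c) w

scanR-avoids : ∀ {c} k (w : Word) → Avoids c w → All (_≢ c) (scanR k w)
scanR-avoids k       []               []      = []
scanR-avoids k       ((d , Lst) ∷ xs) (_ ∷ a) = scanR-avoids (suc k) xs a
scanR-avoids zero    ((d , Rst) ∷ xs) (p ∷ a) = p ∷ scanR-avoids zero xs a
scanR-avoids (suc k) ((d , Rst) ∷ xs) (_ ∷ a) = scanR-avoids k xs a
scanR-avoids k       ((d , Nst) ∷ xs) (_ ∷ a) = scanR-avoids k xs a

scanL-avoids : ∀ {c} k (w : Word) → Avoids c w → All (_≢ c) (scanL k w)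
scanL-avoids k       []               []      = []
scanL-avoids k       ((d , Rst) ∷ xs) (_ ∷ a) = scanL-avoids (suc k) xs a
scanL-avoids zero    ((d , Lst) ∷ xs) (p ∷ a) = p ∷ scanL-avoids zero xs a
scanL-avoids (suc k) ((d , Lst) ∷ xs) (_ ∷ a) = scanL-avoids k xs a
scanL-avoids k       ((d , Nst) ∷ xs) (_ ∷ a) = scanL-avoids k xs a

All-reverse : ∀ {A : Set} {P : A → Set} (xs : List A) → All P xs → All P (reverse xs)
All-reverse []       []      = []
All-reverse (x ∷ xs) (p ∷ a) rewrite unfold-reverse x xs = ∷ʳ⁺ (All-reverse xs a) p

last-∈ : ∀ {A : Set} (xs : List A) {z} → last xs ≡ just z → z ∈ xs
last-∈ (x ∷ [])     refl = here refl
last-∈ (x ∷ y ∷ xs) e    = there (last-∈ (y ∷ xs) e)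

last-avoids : ∀ {c} (xs : List ℕ) → All (_≢ c) xs → last xs ≢ just c
last-avoids xs a e = All.lookup a (last-∈ xs e) refl

last-++-∷ : ∀ {A : Set} (xs : List A) y ys → last (xs ++ y ∷ ys) ≡ last (y ∷ ys)
last-++-∷ []           y ys = refl
last-++-∷ (x ∷ [])     y ys = refl
last-++-∷ (x ∷ x′ ∷ xs) y ys = last-++-∷ (x′ ∷ xs) y ys

last-∷-avoids : ∀ {c} (ys : List ℕ) → All (_≢ c) ys → last (c ∷ ys) ≡ just c → ys ≡ []
last-∷-avoids []       a e = refl
last-∷-avoids (y ∷ ys) a e = ⊥-elim (last-avoids (y ∷ ys) a e)

reverse-++-∷ : ∀ {A : Set} (xs : List A) y ys → reverse (xs ++ y ∷ ys) ≡ reverse ys ++ y ∷ reverse xs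
reverse-++-∷ xs y ys rewrite reverse-++ xs (y ∷ ys) | unfold-reverse y ys = ++-assoc (reverse ys) (y ∷ []) (reverse xs)

-- In P ++ c ∷ Q, the letter ) at c is the rightmost unpaired ) iff P leaves no ( open and Q has no
-- unpaired ); the letter ( at c is the leftmost unpaired ( iff these same two conditions hold.
rightmostR⇒leftmostL : ∀ c (P Q : Word) → Avoids c P → Avoids c Q →
  last (scanR 0 (P ++ (c , Rst) ∷ Q)) ≡ just c → last (scanL 0 (reverse (P ++ (c , Lst) ∷ Q))) ≡ just c
rightmostR⇒leftmostL c P Q aP aQ h rewrite scanR-++ 0 P ((c , Rst) ∷ Q) with depthR 0 P in openP
... | suc k = ⊥-elim (last-avoids _ (++⁺ (scanR-avoids 0 P aP) (scanR-avoids k Q aQ)) h)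
... | zero rewrite last-++-∷ (scanR 0 P) c (scanR 0 Q)
  with noRQ ← last-∷-avoids (scanR 0 Q) (scanR-avoids 0 Q aQ) h
  rewrite reverse-++-∷ P (c , Lst) Q | scanL-++ 0 (reverse Q) ((c , Lst) ∷ reverse P)
        | n≤0⇒n≡0 (scanR≡[]⇒unpairedR≤ Q 0 noRQ)
        | unpairedL≤⇒scanL≡[] (reverse P) 0 (subst (λ w → depthR 0 w ≤ 0) (sym (reverse-involutive P)) (≤-reflexive openP))
  = last-++-∷ (scanL 0 (reverse Q)) c []

leftmostL⇒rightmostR : ∀ c (P Q : Word) → Avoids c P → Avoids c Q →
  last (scanL 0 (reverse (P ++ (c , Lst) ∷ Q))) ≡ just c → last (scanR 0 (P ++ (c , Rst) ∷ Q)) ≡ just c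
leftmostL⇒rightmostR c P Q aP aQ h
  rewrite reverse-++-∷ P (c , Lst) Q | scanL-++ 0 (reverse Q) ((c , Lst) ∷ reverse P) with depthL 0 (reverse Q) in noRQ
... | suc k = ⊥-elim (last-avoids _
  (++⁺ (scanL-avoids 0 (reverse Q) (All-reverse Q aQ)) (scanL-avoids k (reverse P) (All-reverse P aP))) h)
... | zero rewrite last-++-∷ (scanL 0 (reverse Q)) c (scanL 0 (reverse P))
  with noLP ← last-∷-avoids (scanL 0 (reverse P)) (scanL-avoids 0 (reverse P) (All-reverse P aP)) h
  with openP ← scanL≡[]⇒unpairedL≤ (reverse P) 0 noLP
  rewrite reverse-involutive P | scanR-++ 0 P ((c , Rst) ∷ Q) | n≤0⇒n≡0 openP
        | unpairedR≤⇒scanR≡[] Q 0 (≤-reflexive noRQ)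
  = last-++-∷ (scanR 0 P) c []

upTo-split : ∀ m c → c < m →
  Σ (List ℕ) λ as → Σ (List ℕ) λ bs → upTo m ≡ as ++ c ∷ bs × All (_≢ c) as × All (_≢ c) bs
upTo-split (suc m) c c<1+m with <-suc-cases c<1+m
... | inj₂ refl = upTo c , [] , sym (upTo-∷ʳ c) , All.tabulate (λ x∈ x≡c → <-irrefl x≡c (∈-upTo⁻ x∈)) , []
... | inj₁ c<m with as , bs , split , as≢ , bs≢ ← upTo-split m c c<m =
  as , bs ∷ʳ m , trans (sym (upTo-∷ʳ m)) (trans (cong (_∷ʳ m) split) (++-assoc as (c ∷ bs) (m ∷ []))) ,
  as≢ , ∷ʳ⁺ bs≢ (λ m≡c → <-irrefl (sym m≡c) c<m)

∈scanR⇒Rst : ∀ k (w : Word) {x} → x ∈ scanR k w → (x , Rst) ∈ w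
∈scanR⇒Rst k       ((d , Lst) ∷ xs) x∈          = there (∈scanR⇒Rst (suc k) xs x∈)
∈scanR⇒Rst zero    ((d , Rst) ∷ xs) (here refl) = here refl
∈scanR⇒Rst zero    ((d , Rst) ∷ xs) (there x∈)  = there (∈scanR⇒Rst zero xs x∈)
∈scanR⇒Rst (suc k) ((d , Rst) ∷ xs) x∈          = there (∈scanR⇒Rst k xs x∈)
∈scanR⇒Rst k       ((d , Nst) ∷ xs) x∈          = there (∈scanR⇒Rst k xs x∈)

∈scanL⇒Lst : ∀ k (w : Word) {x} → x ∈ scanL k w → (x , Lst) ∈ w
∈scanL⇒Lst k       ((d , Rst) ∷ xs) x∈          = there (∈scanL⇒Lst (suc k) xs x∈)
∈scanL⇒Lst zero    ((d , Lst) ∷ xs) (here refl) = here refl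
∈scanL⇒Lst zero    ((d , Lst) ∷ xs) (there x∈)  = there (∈scanL⇒Lst zero xs x∈)
∈scanL⇒Lst (suc k) ((d , Lst) ∷ xs) x∈          = there (∈scanL⇒Lst k xs x∈)
∈scanL⇒Lst k       ((d , Nst) ∷ xs) x∈          = there (∈scanL⇒Lst k xs x∈)

∈-map-tag⁻ : ∀ (f : ℕ → St) ds {x s} → (x , s) ∈ L.map (λ d → d , f d) ds → x ∈ ds × f x ≡ s
∈-map-tag⁻ f (d ∷ ds) (here refl) = here refl , refl
∈-map-tag⁻ f (d ∷ ds) (there x∈) with x∈ds , fx ← ∈-map-tag⁻ f ds x∈ = there x∈ds , fx

Avoids-map-tag : ∀ {c} (f : ℕ → St) (ds : List ℕ) → All (_≢ c) ds → Avoids c (L.map (λ d → d , f d) ds)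
Avoids-map-tag f []       []      = []
Avoids-map-tag f (d ∷ ds) (p ∷ a) = p ∷ Avoids-map-tag f ds a

rightmostUnpairedR-status : ∀ {n} (A : Filling n) i {c} → rightmostUnpairedR A i ≡ just c →
  c < suc (maxLen A) × status A i c ≡ Rst
rightmostUnpairedR-status A i e
  with c∈ , st ← ∈-map-tag⁻ (status A i) (upTo (suc (maxLen A))) (∈scanR⇒Rst 0 _ (last-∈ _ e)) = ∈-upTo⁻ c∈ , st

leftmostUnpairedL-status : ∀ {n} (A : Filling n) i {c} → leftmostUnpairedL A i ≡ just c →
  c < suc (maxLen A) × status A i c ≡ Lst
leftmostUnpairedL-status A i e
  with c∈ , st ← ∈-map-tag⁻ (status A i) (upTo (suc (maxLen A))) (reverse⁻ (∈scanL⇒Lst 0 _ (last-∈ _ e))) =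
  ∈-upTo⁻ c∈ , st

rightmostUnpairedR⇔leftmostUnpairedL : ∀ {n} (A B : Filling n) i c → maxLen B ≡ maxLen A → c < suc (maxLen A) →
  (∀ d → d ≢ c → status B i d ≡ status A i d) → status A i c ≡ Rst → status B i c ≡ Lst →
  (rightmostUnpairedR A i ≡ just c) ⇔ (leftmostUnpairedL B i ≡ just c)
rightmostUnpairedR⇔leftmostUnpairedL A B i c maxLen≡ c≤ sameOff stA stB
  with as , bs , split , as≢ , bs≢ ← upTo-split (suc (maxLen A)) c c≤ =
  mk⇔ (λ h → subst (λ w → last (scanL 0 (reverse w)) ≡ just c) (sym wordB)
                (rightmostR⇒leftmostL c P Q avP avQ (subst (λ w → last (scanR 0 w) ≡ just c) wordA h)))
      (λ h → subst (λ w → last (scanR 0 w) ≡ just c) (sym wordA)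
                (leftmostL⇒rightmostR c P Q avP avQ (subst (λ w → last (scanL 0 (reverse w)) ≡ just c) wordB h)))
  where
  tagA tagB : ℕ → ℕ × St
  tagA d = d , status A i d
  tagB d = d , status B i d
  P Q : Word
  P = L.map tagA as
  Q = L.map tagA bs
  avP : Avoids c P
  avP = Avoids-map-tag _ as as≢
  avQ : Avoids c Q
  avQ = Avoids-map-tag _ bs bs≢
  agree : ∀ {ds} → All (_≢ c) ds → L.map tagB ds ≡ L.map tagA ds
  agree ds≢ = map-cong-local (All.map (λ {d} d≢c → cong (d ,_) (sameOff d d≢c)) ds≢)
  wordA : statuses A i ≡ P ++ (c , Rst) ∷ Q
  wordA = begin
    L.map tagA (upTo (suc (maxLen A)))     ≡⟨ cong (L.map tagA) split ⟩
    L.map tagA (as ++ c ∷ bs)              ≡⟨ map-++ tagA as (c ∷ bs) ⟩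
    P ++ (c , status A i c) ∷ Q            ≡⟨ cong (λ s → P ++ (c , s) ∷ Q) stA ⟩
    P ++ (c , Rst) ∷ Q                     ∎
    where open ≡-Reasoning
  wordB : statuses B i ≡ P ++ (c , Lst) ∷ Q
  wordB = begin
    L.map tagB (upTo (suc (maxLen B)))     ≡⟨ cong (λ m → L.map tagB (upTo (suc m))) maxLen≡ ⟩
    L.map tagB (upTo (suc (maxLen A)))     ≡⟨ cong (L.map tagB) split ⟩
    L.map tagB (as ++ c ∷ bs)              ≡⟨ map-++ tagB as (c ∷ bs) ⟩
    L.map tagB as ++ (c , status B i c) ∷ L.map tagB bs
                                           ≡⟨ cong₂ (λ xs ys → xs ++ (c , status B i c) ∷ ys) (agree as≢) (agree bs≢) ⟩
    P ++ (c , status B i c) ∷ Q            ≡⟨ cong (λ s → P ++ (c , s) ∷ Q) stB ⟩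
    P ++ (c , Lst) ∷ Q                     ∎
    where open ≡-Reasoning

swapV-i : ∀ i → swapV i i ≡ suc i
swapV-i i rewrite ≡ᵇ-refl i = refl

swapV-suc : ∀ i → swapV i (suc i) ≡ i
swapV-suc i rewrite ≡ᵇ-≢ (suc i) i (λ e → <-irrefl (sym e) ≤-refl) | ≡ᵇ-refl (suc i) = refl

swapV-other : ∀ i x → x ≢ i → x ≢ suc i → swapV i x ≡ x
swapV-other i x x≢i x≢1+i rewrite ≡ᵇ-≢ x i x≢i | ≡ᵇ-≢ x (suc i) x≢1+i = refl

swapV-involutive : ∀ i x → swapV i (swapV i x) ≡ x
swapV-involutive i x with x ≟ i
... | yes refl rewrite swapV-i x = swapV-suc x
... | no x≢i with x ≟ suc i
...   | yes refl rewrite swapV-suc i = swapV-i i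
...   | no x≢1+i rewrite swapV-other i x x≢i x≢1+i = swapV-other i x x≢i x≢1+i

swapIf-involutive : ∀ i b b′ x → swapIf i b (swapIf i b′ (swapIf i b (swapIf i b′ x))) ≡ x
swapIf-involutive i b b′ x = trans (cong (swapIf i b) (swap-commute b′ b _)) (trans (cancel b _) (cancel b′ x))
  where
  map-swap-involutive : ∀ y → M.map (swapV i) (M.map (swapV i) y) ≡ y
  map-swap-involutive (just y) = cong just (swapV-involutive i y)
  map-swap-involutive nothing  = refl
  cancel : ∀ b y → swapIf i b (swapIf i b y) ≡ y
  cancel true  y = map-swap-involutive y
  cancel false y = refl
  swap-commute : ∀ b b′ y → swapIf i b (swapIf i b′ y) ≡ swapIf i b′ (swapIf i b y)
  swap-commute true  true  y = refl
  swap-commute true  false y = refl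
  swap-commute false b′    y = refl

Transposed : ℕ → ℕ → ℕ → Set
Transposed i u w = (u ≡ suc i × w ≡ i) ⊎ (u ≡ i × w ≡ suc i)

Transposed-sym : ∀ {i u w} → Transposed i u w → Transposed i w u
Transposed-sym (inj₁ (u≡ , w≡)) = inj₂ (w≡ , u≡)
Transposed-sym (inj₂ (u≡ , w≡)) = inj₁ (w≡ , u≡)

swapV-transposed : ∀ {i u w} → Transposed i u w → swapV i u ≡ w
swapV-transposed {i} (inj₁ (refl , refl)) = swapV-suc i
swapV-transposed {i} (inj₂ (refl , refl)) = swapV-i i

Transposed⇒≢ : ∀ {i u w} → Transposed i u w → u ≢ w
Transposed⇒≢ (inj₁ (refl , refl)) e = <-irrefl (sym e) ≤-refl
Transposed⇒≢ (inj₂ (refl , refl)) e = <-irrefl e ≤-refl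

status-both : ∀ {i u w} → Transposed i u w → ∀ {n} (T : Filling n) d s s′ →
  ent T s d ≡ just u → ent T s′ d ≡ just w → status T i d ≡ Nst
status-both {i} (inj₁ (refl , refl)) T d s s′ eu ew
  rewrite status≡statusOf T i d | inCol-intro T s d (suc i) eu | inCol-intro T s′ d i ew = refl
status-both {i} (inj₂ (refl , refl)) T d s s′ eu ew
  rewrite status≡statusOf T i d | inCol-intro T s d i eu | inCol-intro T s′ d (suc i) ew = refl

record NonAttacking {n : ℕ} (T : Filling n) : Set where
  field
    nonAttCol : ∀ r s c u v → r ≢ s → ent T r c ≡ just u → ent T s c ≡ just v → u ≢ v
    nonAttAdj : ∀ r s c u v → s < r → ent T r c ≡ just u → ent T s (suc c) ≡ just v → u ≢ v

SSKD⇒NonAttacking : ∀ {n} {a : Vec ℕ n} {T : Filling n} → SSKD a T → NonAttacking T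
SSKD⇒NonAttacking sT = record { nonAttCol = SSKD.nonAttCol sT ; nonAttAdj = SSKD.nonAttAdj sT }

exchange : ∀ {n} → ℕ → ℕ → ℕ → Filling n → ℕ → ℕ → Filling n
exchange i u w T c r =
  swapCols i (chainL (λ d → hasAt T r d u ∧ above T r d w) c)
    (swapCols i (chainR (λ d → hasAt T r d u ∧ below T r d w) (maxLen T) c)
      (setCell T r c w))

module Exchange {n} (i u w : ℕ) (uw : Transposed i u w) (X : Filling n) (nX : NonAttacking X)
                (r₀ c₀ : ℕ) (eX : ent X (suc r₀) (suc c₀) ≡ just u) where

  open NonAttacking nX

  r c : ℕ
  r = suc r₀
  c = suc c₀

  pL pR : ℕ → Bool
  pL d = hasAt X r d u ∧ above X r d w
  pR d = hasAt X r d u ∧ below X r d w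

  Z Y : Filling n
  Z = setCell X r c w
  Y = exchange i u w X c r

  qL qR : ℕ → Bool
  qL d = hasAt Y r d w ∧ above Y r d u
  qR d = hasAt Y r d w ∧ below Y r d u

  swapV-u : swapV i u ≡ w
  swapV-u = swapV-transposed uw

  swapV-w : swapV i w ≡ u
  swapV-w = swapV-transposed (Transposed-sym uw)

  maxLen-Y : maxLen Y ≡ maxLen X
  maxLen-Y = trans (maxLen-swapCols i (chainL pL c) _)
                   (trans (maxLen-swapCols i (chainR pR (maxLen X) c) Z) (maxLen-setCell X r c w))

  ent-Y : ∀ r′ d → ent Y r′ d ≡ swapIf i (inChainL pL c d) (swapIf i (inChainR pR (maxLen X) c d) (ent Z r′ d))
  ent-Y r′ d = trans (ent-swapCols-chainL i pL c _ r′ d)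
                     (cong (swapIf i (inChainL pL c d)) (ent-swapCols-chainR i pR (maxLen X) c Z r′ d))

  c∉chainL : inChainL pL c c ≡ false
  c∉chainL = ≢true⇒false λ e → <-irrefl refl (proj₁ (proj₂ (inChainL⇒ pL c c e)))

  c∉chainR : inChainR pR (maxLen X) c c ≡ false
  c∉chainR = ≢true⇒false λ e → <-irrefl refl (proj₁ (inChainR⇒ pR (maxLen X) c c e))

  ∈chainL⇒∉chainR : ∀ {d} → inChainL pL c d ≡ true → inChainR pR (maxLen X) c d ≡ false
  ∈chainL⇒∉chainR e = ≢true⇒false λ e′ →
    <-asym (proj₁ (proj₂ (inChainL⇒ pL c _ e))) (proj₁ (inChainR⇒ pR (maxLen X) c _ e′))

  ∈chainR⇒∉chainL : ∀ {d} → inChainR pR (maxLen X) c d ≡ true → inChainL pL c d ≡ false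
  ∈chainR⇒∉chainL e = ≢true⇒false λ e′ →
    <-asym (proj₁ (proj₂ (inChainL⇒ pL c _ e′))) (proj₁ (inChainR⇒ pR (maxLen X) c _ e))

  ent-Z-≢ : ∀ r′ d → d ≢ c → ent Z r′ d ≡ ent X r′ d
  ent-Z-≢ r′ d d≢c = ent-setCell-≢ X r₀ c₀ w r′ d (inj₂ d≢c)

  ent-Y-chainL : ∀ r′ d → inChainL pL c d ≡ true → ent Y r′ d ≡ M.map (swapV i) (ent X r′ d)
  ent-Y-chainL r′ d e rewrite ent-Y r′ d | e | ∈chainL⇒∉chainR e
    | ent-Z-≢ r′ d (λ d≡c → <-irrefl d≡c (proj₁ (proj₂ (inChainL⇒ pL c d e)))) = refl

  ent-Y-chainR : ∀ r′ d → inChainR pR (maxLen X) c d ≡ true → ent Y r′ d ≡ M.map (swapV i) (ent X r′ d)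
  ent-Y-chainR r′ d e rewrite ent-Y r′ d | e | ∈chainR⇒∉chainL e
    | ent-Z-≢ r′ d (λ d≡c → <-irrefl (sym d≡c) (proj₁ (inChainR⇒ pR (maxLen X) c d e))) = refl

  ent-Y-unchanged : ∀ r′ d → inChainL pL c d ≡ false → inChainR pR (maxLen X) c d ≡ false → d ≢ c →
    ent Y r′ d ≡ ent X r′ d
  ent-Y-unchanged r′ d eL eR d≢c rewrite ent-Y r′ d | eL | eR = ent-Z-≢ r′ d d≢c

  ent-Y-rc : ent Y r c ≡ just w
  ent-Y-rc rewrite ent-Y r c | c∉chainL | c∉chainR = trans (ent-setCell X r₀ c₀ w) (cong (M.map (λ _ → w)) eX)

  ent-Y-c : ∀ r′ → r′ ≢ r → ent Y r′ c ≡ ent X r′ c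
  ent-Y-c r′ r′≢r rewrite ent-Y r′ c | c∉chainL | c∉chainR = ent-setCell-≢ X r₀ c₀ w r′ c (inj₁ r′≢r)

  swapped : ∀ r′ d {x} → ent Y r′ d ≡ M.map (swapV i) (ent X r′ d) → ent X r′ d ≡ just x → ent Y r′ d ≡ just (swapV i x)
  swapped r′ d eY eX′ = trans eY (cong (M.map (swapV i)) eX′)

  chainL⇒qL : ∀ d → inChainL pL c d ≡ true → qL d ≡ true
  chainL⇒qL d e with _ , d<c , chain ← inChainL⇒ pL c d e
    with u-here , w-above ← ∧-true (hasAt X r d u) _ (chain d ≤-refl d<c)
    with s , r<s , es ← above-elim X r d w w-above =
    ∧-intro (hasAt-complete Y r d w (trans (swapped r d (ent-Y-chainL r d e) (hasAt-sound X r d u u-here)) (cong just swapV-u)))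
            (above-intro Y r s d u r<s (trans (swapped s d (ent-Y-chainL s d e) es) (cong just swapV-w)))

  chainR⇒qR : ∀ d → inChainR pR (maxLen X) c d ≡ true → qR d ≡ true
  chainR⇒qR d e with c<d , _ , chain ← inChainR⇒ pR (maxLen X) c d e
    with u-here , w-below ← ∧-true (hasAt X r d u) _ (chain d c<d ≤-refl)
    with s , s<r , es ← below-elim X r d w w-below =
    ∧-intro (hasAt-complete Y r d w (trans (swapped r d (ent-Y-chainR r d e) (hasAt-sound X r d u u-here)) (cong just swapV-u)))
            (below-intro Y r s d u s<r (trans (swapped s d (ent-Y-chainR s d e) es) (cong just swapV-w)))

  -- Non-attacking is what keeps the chains of Y from running past those of X: column d is unchanged,
  -- and a u above (resp. below) row r there would attack the u next to it in row r.
  qL-blocked : ∀ d → d < c → pL d ≡ false → ent X r (suc d) ≡ just u → qL d ≡ false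
  qL-blocked d d<c pd ex = ≢true⇒false λ e →
    let eL = ≢true⇒false λ e′ → true≢false (proj₂ (proj₂ (inChainL⇒ pL c d e′)) d ≤-refl d<c) pd
        eR = ≢true⇒false λ e′ → <-asym d<c (proj₁ (inChainR⇒ pR (maxLen X) c d e′))
        (s , r<s , es) = above-elim Y r d u (proj₂ (∧-true (hasAt Y r d w) _ e))
    in nonAttAdj s r d u u r<s (trans (sym (ent-Y-unchanged s d eL eR (λ d≡c → <-irrefl d≡c d<c))) es) ex refl

  qR-blocked : ∀ d → c < suc d → pR (suc d) ≡ false → ent X r d ≡ just u → qR (suc d) ≡ false
  qR-blocked d c<1+d pd ex = ≢true⇒false λ e →
    let eR = ≢true⇒false λ e′ → true≢false (proj₂ (proj₂ (inChainR⇒ pR (maxLen X) c (suc d) e′)) (suc d) c<1+d ≤-refl) pd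
        eL = ≢true⇒false λ e′ → <-asym c<1+d (proj₁ (proj₂ (inChainL⇒ pL c (suc d) e′)))
        (s , s<r , es) = below-elim Y r (suc d) u (proj₂ (∧-true (hasAt Y r (suc d) w) _ e))
    in nonAttAdj r s d u u s<r ex (trans (sym (ent-Y-unchanged s (suc d) eL eR (λ d≡c → <-irrefl (sym d≡c) c<1+d))) es) refl

  chainL-Y : chainL qL c ≡ chainL pL c
  chainL-Y = chainL-cong pL qL c agree
    where
    agree : ∀ d → 1 ≤ d → d < c → (∀ e → d < e → e < c → pL e ≡ true) → qL d ≡ pL d
    agree d 1≤d d<c chain with pL d in pd
    ... | true  = chainL⇒qL d (inChainL⇐ pL c d (1≤d , d<c , extend-≤ {λ x → pL x ≡ true} pd chain))
    ... | false = qL-blocked d d<c pd u-right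
      where
      u-right : ent X r (suc d) ≡ just u
      u-right with m≤n⇒m<n∨m≡n d<c
      ... | inj₂ refl  = eX
      ... | inj₁ 1+d<c = hasAt-sound X r (suc d) u (proj₁ (∧-true (hasAt X r (suc d) u) _ (chain (suc d) ≤-refl 1+d<c)))

  chainR-Y : chainR qR (maxLen Y) c ≡ chainR pR (maxLen X) c
  chainR-Y rewrite maxLen-Y = chainR-cong pR qR (maxLen X) c agree
    where
    agree : ∀ d → c < d → d ≤ c + maxLen X → (∀ e → c < e → e < d → pR e ≡ true) → qR d ≡ pR d
    agree d c<d d≤ chain with pR d in pd
    ... | true = chainR⇒qR d (inChainR⇐ pR (maxLen X) c d (c<d , d≤ , extend-≥ {λ x → pR x ≡ true} pd chain))
    agree (suc d) c<d d≤ chain | false = qR-blocked d c<d pd u-left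
      where
      u-left : ent X r d ≡ just u
      u-left with m≤n⇒m<n∨m≡n (≤-pred c<d)
      ... | inj₂ refl = eX
      ... | inj₁ c<d′ = hasAt-sound X r d u (proj₁ (∧-true (hasAt X r d u) _ (chain d c<d′ ≤-refl)))

  exchange-involutive : exchange i w u Y c r ≡ X
  exchange-involutive rewrite chainL-Y | chainR-Y = Filling-ext _ X λ r′ d → begin
    ent (swapCols i (chainL pL c) (swapCols i (chainR pR (maxLen X) c) (setCell Y r c u))) r′ d
      ≡⟨ ent-swapCols-chainL i pL c _ r′ d ⟩
    swapIf i (inChainL pL c d) (ent (swapCols i (chainR pR (maxLen X) c) (setCell Y r c u)) r′ d)
      ≡⟨ cong (swapIf i (inChainL pL c d)) (ent-swapCols-chainR i pR (maxLen X) c _ r′ d) ⟩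
    swapIf i (inChainL pL c d) (swapIf i (inChainR pR (maxLen X) c d) (ent (setCell Y r c u) r′ d))
      ≡⟨ undo r′ d ⟩
    ent X r′ d ∎
    where
    open ≡-Reasoning
    undo : ∀ r′ d → swapIf i (inChainL pL c d) (swapIf i (inChainR pR (maxLen X) c d) (ent (setCell Y r c u) r′ d)) ≡ ent X r′ d
    undo r′ d with d ≟ c
    undo r′ d | yes refl rewrite c∉chainL | c∉chainR with r′ ≟ r
    ... | yes refl = trans (ent-setCell Y r₀ c₀ u) (trans (cong (M.map (λ _ → u)) ent-Y-rc) (sym eX))
    ... | no r′≢r  = trans (ent-setCell-≢ Y r₀ c₀ u r′ c (inj₁ r′≢r)) (ent-Y-c r′ r′≢r)
    undo r′ d | no d≢c rewrite ent-setCell-≢ Y r₀ c₀ u r′ d (inj₂ d≢c) | ent-Y r′ d | ent-Z-≢ r′ d d≢c =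
      swapIf-involutive i (inChainL pL c d) (inChainR pR (maxLen X) c d) (ent X r′ d)

  status-swapped : ∀ d s → (∀ r′ → ent Y r′ d ≡ M.map (swapV i) (ent X r′ d)) →
    ent X r d ≡ just u → ent X s d ≡ just w → status Y i d ≡ status X i d
  status-swapped d s swap eu ew =
    trans (status-both uw Y d s r (trans (swapped s d (swap s) ew) (cong just swapV-w))
                                  (trans (swapped r d (swap r) eu) (cong just swapV-u)))
          (sym (status-both uw X d r s eu ew))

  status-Y-≢ : ∀ d → d ≢ c → status Y i d ≡ status X i d
  status-Y-≢ d d≢c with inChainL pL c d in eL
  ... | true with _ , d<c , chain ← inChainL⇒ pL c d eL
    with u-here , w-above ← ∧-true (hasAt X r d u) _ (chain d ≤-refl d<c)
    with s , _ , es ← above-elim X r d w w-above =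
    status-swapped d s (λ r′ → ent-Y-chainL r′ d eL) (hasAt-sound X r d u u-here) es
  status-Y-≢ d d≢c | false with inChainR pR (maxLen X) c d in eR
  ... | true with c<d , _ , chain ← inChainR⇒ pR (maxLen X) c d eR
    with u-here , w-below ← ∧-true (hasAt X r d u) _ (chain d c<d ≤-refl)
    with s , _ , es ← below-elim X r d w w-below =
    status-swapped d s (λ r′ → ent-Y-chainR r′ d eR) (hasAt-sound X r d u u-here) es
  ... | false = status-column-cong Y X i d (λ r′ → ent-Y-unchanged r′ d eL eR d≢c)

  inCol-Y-w : inCol Y c w ≡ true
  inCol-Y-w = inCol-intro Y r c w ent-Y-rc

  inCol-Y-u : inCol Y c u ≡ false
  inCol-Y-u = inCol-false Y c u no-u
    where
    no-u : ∀ r′ → ent Y r′ c ≢ just u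
    no-u r′ e with r′ ≟ r
    ... | yes refl = Transposed⇒≢ uw (just-injective (trans (sym e) ent-Y-rc))
    ... | no r′≢r  = nonAttCol r′ r c u u r′≢r (trans (sym (ent-Y-c r′ r′≢r)) e) eX refl

  findRow-Y : NonAttacking Y → findRow Y c w ≡ just r
  findRow-Y nY = findRow-unique Y c w r ent-Y-rc unique
    where
    unique : ∀ r′ → ent Y r′ c ≡ just w → r′ ≡ r
    unique r′ e with r′ ≟ r
    ... | yes r′≡r = r′≡r
    ... | no r′≢r  = ⊥-elim (NonAttacking.nonAttCol nY r′ r c w w r′≢r e ent-Y-rc refl)

  -- If the left chain of Y reached the basement, so would that of X, and the basement entry r would be u.
  qL-throughout⇒r≡u : (∀ d → d < c → qL d ≡ true) → r ≡ u
  qL-throughout⇒r≡u qL< = let e = u-from 0 c refl in just-injective (trans (sym (basement r e)) e)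
    where
    basement : ∀ r′ → ent X r′ 0 ≡ just u → ent X r′ 0 ≡ just r′
    basement r′ e rewrite ent≡entryOf X r′ 0 with rowOf X r′ | e
    ... | just _ | _ = refl
    u-from : ∀ d g → d + g ≡ c → ent X r d ≡ just u
    u-from d zero    d+0≡c rewrite +-identityʳ d | d+0≡c = eX
    u-from d (suc g) d+g≡c with pL d in pd
    ... | true  = hasAt-sound X r d u (proj₁ (∧-true (hasAt X r d u) _ pd))
    ... | false = ⊥-elim (true≢false (qL< d d<c) (qL-blocked d d<c pd (u-from (suc d) g (trans (sym (+-suc d g)) d+g≡c))))
      where
      d<c : d < c
      d<c = subst (d <_) d+g≡c (m<m+n d z<s)

lowerBlocked : ∀ {n} → ℕ → Filling n → ℕ → ℕ → Bool
lowerBlocked i T c r = (r ≡ᵇ i) ∧ all (λ d → hasAt T r d i ∧ above T r d (suc i)) (upTo c)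

raise≡just⇒ : ∀ {n} i (S T : Filling n) → raise i S ≡ just T →
  Σ ℕ λ c → Σ ℕ λ r → rightmostUnpairedR S i ≡ just c × findRow S c (suc i) ≡ just r × T ≡ exchange i (suc i) i S c r
raise≡just⇒ i S T e with rightmostUnpairedR S i in eC
... | just c with findRow S c (suc i) in eR
...   | just r = c , r , refl , eR , sym (just-injective e)

raise-exchange : ∀ {n} i (S : Filling n) c r → rightmostUnpairedR S i ≡ just c → findRow S c (suc i) ≡ just r →
  raise i S ≡ just (exchange i (suc i) i S c r)
raise-exchange i S c r eC eR with rightmostUnpairedR S i | eC
... | just .c | refl with findRow S c (suc i) | eR
...   | just .r | refl = refl

lower≡just⇒ : ∀ {n} i (T S : Filling n) → lower i T ≡ just S →
  Σ ℕ λ c → Σ ℕ λ r → leftmostUnpairedL T i ≡ just c × findRow T c i ≡ just r × S ≡ exchange i i (suc i) T c r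
lower≡just⇒ i T S e with leftmostUnpairedL T i in eC
... | just c with findRow T c i in eR
...   | just r with lowerBlocked i T c r
...     | false = c , r , refl , eR , sym (just-injective e)

lower-exchange : ∀ {n} i (T : Filling n) c r → leftmostUnpairedL T i ≡ just c → findRow T c i ≡ just r →
  lowerBlocked i T c r ≡ false → lower i T ≡ just (exchange i i (suc i) T c r)
lower-exchange i T c r eC eR eB with leftmostUnpairedL T i | eC
... | just .c | refl with findRow T c i | eR
...   | just .r | refl with lowerBlocked i T c r | eB
...     | false | refl = refl

ent-basement : ∀ {n} (X : Filling n) k → k < n → ent X (suc k) 0 ≡ just (suc k)
ent-basement X k k<n rewrite ent≡entryOf X (suc k) 0 with at (V.toList X) k | at-toList-< X k k<n
... | just _ | _ , refl = refl

ent⇒row-suc : ∀ {n} (X : Filling n) r c {v} → ent X r c ≡ just v → Σ ℕ λ r₀ → r ≡ suc r₀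
ent⇒row-suc X zero c e rewrite ent≡entryOf X zero c with c | e
... | zero  | ()
... | suc _ | ()
ent⇒row-suc X (suc r) c e = r , refl

-- The basement column holds both i (row i) and i+1 (row i+1), so it never carries an unpaired letter.
status-basement : ∀ {n} (X : Filling n) i → 1 ≤ i → i < n → status X i 0 ≡ Nst
status-basement X (suc i₀) 1≤i i<n rewrite status≡statusOf X (suc i₀) 0
  | inCol-intro X (suc i₀) 0 (suc i₀) (ent-basement X i₀ (<-trans ≤-refl i<n))
  | inCol-intro X (suc (suc i₀)) 0 (suc (suc i₀)) (ent-basement X (suc i₀) i<n) = refl

unpaired⇒column-suc : ∀ {n} (X : Filling n) i c s → 1 ≤ i → i < n → status X i c ≡ s → s ≢ Nst →
  Σ ℕ λ c₀ → c ≡ suc c₀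
unpaired⇒column-suc X i zero    s 1≤i i<n st s≢N = ⊥-elim (s≢N (trans (sym st) (status-basement X i 1≤i i<n)))
unpaired⇒column-suc X i (suc c) s 1≤i i<n st s≢N = c , refl

raise⇒lower : ∀ {n} i → 1 ≤ i → i < n → (S T : Filling n) → NonAttacking S → NonAttacking T →
  raise i S ≡ just T → lower i T ≡ just S
raise⇒lower i 1≤i i<n S T nS nT e with c , r , eC , eR , refl ← raise≡just⇒ i S T e
  with eS ← findRow-sound S c (suc i) eR
  with r₀ , refl ← ent⇒row-suc S r c eS
  with c≤ , stS ← rightmostUnpairedR-status S i eC
  with c₀ , refl ← unpaired⇒column-suc S i c Rst 1≤i i<n stS (λ ())
  = trans (lower-exchange i T c r leftmost (findRow-Y nT) unblocked) (cong just exchange-involutive)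
  where
  open Exchange i (suc i) i (inj₁ (refl , refl)) S nS r₀ c₀ eS
    using (maxLen-Y; status-Y-≢; inCol-Y-w; inCol-Y-u; findRow-Y; exchange-involutive; qL-throughout⇒r≡u)
  stT : status T i c ≡ Lst
  stT rewrite status≡statusOf T i c | inCol-Y-w | inCol-Y-u = refl
  leftmost : leftmostUnpairedL T i ≡ just c
  leftmost = Equivalence.to
    (rightmostUnpairedR⇔leftmostUnpairedL S T i c maxLen-Y c≤ status-Y-≢ stS stT) eC
  unblocked : lowerBlocked i T c r ≡ false
  unblocked = ≢true⇒false λ e →
    let r≡i , qL-all = ∧-true (r ≡ᵇ i) _ e
    in <-irrefl (trans (sym (≡ᵇ-sound r i r≡i)) (qL-throughout⇒r≡u λ d d<c → all-elim _ (upTo c) qL-all (∈-upTo⁺ d<c))) ≤-refl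

lower⇒raise : ∀ {n} i → 1 ≤ i → i < n → (S T : Filling n) → NonAttacking S → NonAttacking T →
  lower i T ≡ just S → raise i S ≡ just T
lower⇒raise i 1≤i i<n S T nS nT e with c , r , eC , eR , refl ← lower≡just⇒ i T S e
  with eT ← findRow-sound T c i eR
  with r₀ , refl ← ent⇒row-suc T r c eT
  with c≤ , stT ← leftmostUnpairedL-status T i eC
  with c₀ , refl ← unpaired⇒column-suc T i c Lst 1≤i i<n stT (λ ())
  = trans (raise-exchange i S c r rightmost (findRow-Y nS)) (cong just exchange-involutive)
  where
  open Exchange i i (suc i) (inj₂ (refl , refl)) T nT r₀ c₀ eT
    using (maxLen-Y; status-Y-≢; inCol-Y-w; inCol-Y-u; findRow-Y; exchange-involutive)
  stS : status S i c ≡ Rst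
  stS rewrite status≡statusOf S i c | inCol-Y-w | inCol-Y-u = refl
  rightmost : rightmostUnpairedR S i ≡ just c
  rightmost = Equivalence.from
    (rightmostUnpairedR⇔leftmostUnpairedL S T i c (sym maxLen-Y) (subst (λ m → c < suc m) (sym maxLen-Y) c≤)
      (λ d d≢c → sym (status-Y-≢ d d≢c)) stS stT) eC

theorem5p14 : (n : ℕ) (a : Vec ℕ n) (i : ℕ) → 1 ≤ i → i < n →
    (S T : Filling n) → SSKD a S → SSKD a T →
    (raise i S ≡ just T) ⇔ (lower i T ≡ just S)
theorem5p14 n a i 1≤i i<n S T sS sT =
  mk⇔ (raise⇒lower i 1≤i i<n S T nS nT) (lower⇒raise i 1≤i i<n S T nS nT)
  where
  nS = SSKD⇒NonAttacking sS
  nT = SSKD⇒NonAttacking sT
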